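{- Let $\mathcal{K}$ be the class of algebras $(A,\wedge,\vee,\neg,\Box,\Diamond)$ such that $(A,\wedge,\vee)$ is a lattice, $\neg a=\max\{b\in A: a\wedge b\le c \text{ for all } c\in A\}$, $\Box a=\max\{b\in A: a\vee\neg b=1\}$ and $\Diamond a=\min\{b\in A: \neg a\vee b=1\}$ for every $a\in A$ (where $1$ is the top element). Then $\mathcal{K}$ is an equational class. More precisely, writing $1$ for the term $\neg(x\wedge\neg x)$ and $s\preccurlyeq t$ for the identity $s\wedge t\approx s$, $\mathcal{K}$ is exactly the class of algebras of type $(2,2,1,1,1)$ satisfying the lattice identities together with $x\wedge\neg x\preccurlyeq y$, $\; y\preccurlyeq\neg(x\wedge\neg x)$, $\; x\wedge\neg(x\wedge y)\preccurlyeq\neg y$, $x\vee\neg\Box x\approx 1$, $\;\Box 1\approx 1$, $\;\Box(x\vee\neg y)\wedge y\approx\Box x\wedge y$, $\neg x\vee\Diamond x\approx 1$, $\;\Diamond x\preccurlyeq\Diamond(x\vee y)$, $\;\Diamond\Box x\preccurlyeq x$.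
   Context: Lattices here are not assumed distributive. A lattice in which $\neg a$ (as defined) exists for every $a$ is called meet-complemented; it is automatically bounded, with least element $0$ and greatest element $1=\neg(a\wedge\neg a)$ for any $a$. -}

module Defs where

open import Level using (Level; suc; _⊔_)
open import Data.Product using (_×_; Σ)
open import Algebra.Core using (Op₁; Op₂)
open import Algebra.Lattice.Structures using (IsLattice)
open import Relation.Binary.PropositionalEquality using (_≡_)

record Alg (a : Level) : Set (suc a) where
  infixr 7 _∧_
  infixr 6 _∨_
  field
    Carrier : Set a
    _∧_ _∨_ : Op₂ Carrier
    ¬_ □ ◇  : Op₁ Carrier

module _ {a : Level} (𝔸 : Alg a) where
  open Alg 𝔸

  _≼_ : Carrier → Carrier → Set a
  s ≼ t = (s ∧ t) ≡ s

  IsMax : (Carrier → Set a) → Carrier → Set a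
  IsMax P m = P m × (∀ b → P b → b ≼ m)

  IsMin : (Carrier → Set a) → Carrier → Set a
  IsMin P m = P m × (∀ b → P b → m ≼ b)

  IsTop : Carrier → Set a
  IsTop x = ∀ c → c ≼ x

  InK : Set a
  InK = IsLattice _≡_ _∨_ _∧_
      × (∀ x → IsMax (λ b → ∀ c → (x ∧ b) ≼ c) (¬ x))
      × (∀ x → IsMax (λ b → IsTop (x ∨ (¬ b))) (□ x))
      × (∀ x → IsMin (λ b → IsTop ((¬ x) ∨ b)) (◇ x))

  𝟏 : Carrier → Carrier
  𝟏 x = ¬ (x ∧ ¬ x)

  Axioms : Set a
  Axioms = IsLattice _≡_ _∨_ _∧_
      × (∀ x y → (x ∧ ¬ x) ≼ y)
      × (∀ x y → y ≼ (¬ (x ∧ ¬ x)))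
      × (∀ x y → (x ∧ ¬ (x ∧ y)) ≼ (¬ y))
      × (∀ x → (x ∨ ¬ (□ x)) ≡ 𝟏 x)
      × (∀ x → □ (𝟏 x) ≡ 𝟏 x)
      × (∀ x y → (□ (x ∨ ¬ y) ∧ y) ≡ (□ x ∧ y))
      × (∀ x → ((¬ x) ∨ ◇ x) ≡ 𝟏 x)
      × (∀ x y → ◇ x ≼ ◇ (x ∨ y))
      × (∀ x → ◇ (□ x) ≼ x)

module Submission where

-- The class 𝒦 is defined by three universal properties: ¬ x is the
-- meet-complement of x, □ x is the largest b with x ∨ ¬ b = 1, and ◇ x is
-- the smallest b with ¬ x ∨ b = 1.  Each universal property is equivalent,
-- in the presence of the previous ones, to its own group of three identities:
--
--   * ¬ is a meet-complement   ⇔  x ∧ ¬x ≼ y,  y ≼ 1,  x ∧ ¬(x ∧ y) ≼ ¬y;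
--   * (given ¬) □ is maximal   ⇔  x ∨ ¬□x = 1,  □1 = 1,  □(x ∨ ¬y) ∧ y = □x ∧ y;
--   * (given ¬, □) ◇ is minimal ⇔ ¬x ∨ ◇x = 1,  ◇x ≼ ◇(x ∨ y),  ◇□x ≼ x.

open import Defs using (Alg; InK; Axioms)
import Defs
open import Level using (Level)
open import Function.Bundles using (_⇔_; mk⇔; Equivalence)
open import Data.Product using (_×_; _,_; proj₁; proj₂)
open import Algebra.Lattice.Structures using (IsLattice)
import Algebra.Lattice.Properties.Lattice as AlgebraicLattice
import Relation.Binary.Lattice as OrderLattice
import Relation.Binary.Lattice.Properties.JoinSemilattice as JoinProperties
import Relation.Binary.Lattice.Properties.MeetSemilattice as MeetProperties
open import Relation.Binary.PropositionalEquality
open ≡-Reasoning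

module Theory {a : Level} (𝔸 : Alg a) (L : IsLattice _≡_ (Alg._∨_ 𝔸) (Alg._∧_ 𝔸)) where
  open Alg 𝔸
  open IsLattice L using (∧-comm; ∧-assoc; ∨-comm; ∨-assoc)

  infix 4 _≼_

  _≼_ : Carrier → Carrier → Set a
  _≼_ = Defs._≼_ 𝔸

  𝟏 : Carrier → Carrier
  𝟏 = Defs.𝟏 𝔸

  IsTop : Carrier → Set a
  IsTop = Defs.IsTop 𝔸

  IsMax IsMin : (Carrier → Set a) → Carrier → Set a
  IsMax = Defs.IsMax 𝔸
  IsMin = Defs.IsMin 𝔸

  -- The lattice order.  The library orders a lattice by x ≈ x ∧ y, which is
  -- the symmetric form of x ≼ y, so each fact below is a library fact up to sym.

  private
    order : OrderLattice.Lattice a a a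
    order = AlgebraicLattice.∨-∧-orderTheoreticLattice
      (record { Carrier = Carrier ; _≈_ = _≡_ ; _∨_ = _∨_ ; _∧_ = _∧_ ; isLattice = L })
    module O = OrderLattice.Lattice order

  ≼-refl : ∀ x → x ≼ x
  ≼-refl x = sym (O.refl {x})

  ≼-trans : ∀ {x y z} → x ≼ y → y ≼ z → x ≼ z
  ≼-trans p q = sym (O.trans (sym p) (sym q))

  ≼-antisym : ∀ {x y} → x ≼ y → y ≼ x → x ≡ y
  ≼-antisym p q = O.antisym (sym p) (sym q)

  x∧y≼x : ∀ x y → x ∧ y ≼ x
  x∧y≼x x y = sym (O.x∧y≤x x y)

  x∧y≼y : ∀ x y → x ∧ y ≼ y
  x∧y≼y x y = sym (O.x∧y≤y x y)

  ∧-greatest : ∀ {x y z} → x ≼ y → x ≼ z → x ≼ y ∧ z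
  ∧-greatest p q = sym (O.∧-greatest (sym p) (sym q))

  x≼x∨y : ∀ x y → x ≼ x ∨ y
  x≼x∨y x y = sym (O.x≤x∨y x y)

  ∨-least : ∀ {x y z} → x ≼ z → y ≼ z → x ∨ y ≼ z
  ∨-least p q = sym (O.∨-least (sym p) (sym q))

  ∨-mono : ∀ {x y u v} → x ≼ u → y ≼ v → x ∨ y ≼ u ∨ v
  ∨-mono p q = sym (JoinProperties.∨-monotonic O.joinSemilattice (sym p) (sym q))

  ∧-mono : ∀ {x y u v} → x ≼ u → y ≼ v → x ∧ y ≼ u ∧ v
  ∧-mono p q = sym (MeetProperties.∧-monotonic O.meetSemilattice (sym p) (sym q))

  ≼⇒∨≡ : ∀ {x y} → x ≼ y → x ∨ y ≡ y
  ≼⇒∨≡ p = JoinProperties.x≤y⇒x∨y≈y O.joinSemilattice (sym p)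

  top-unique : ∀ {t u} → IsTop t → IsTop u → t ≡ u
  top-unique t-top u-top = ≼-antisym (u-top _) (t-top _)

  top-comm : ∀ {x y} → IsTop (x ∨ y) → IsTop (y ∨ x)
  top-comm {x} {y} = subst IsTop (∨-comm x y)

  NegIsMeetComplement : Set a
  NegIsMeetComplement = ∀ x → IsMax (λ b → ∀ c → x ∧ b ≼ c) (¬ x)

  NegAxioms : Set a
  NegAxioms = (∀ x y → x ∧ ¬ x ≼ y)
            × (∀ x y → y ≼ 𝟏 x)
            × (∀ x y → x ∧ ¬ (x ∧ y) ≼ ¬ y)

  negAxioms⇒negIsMeetComplement : NegAxioms → NegIsMeetComplement
  negAxioms⇒negIsMeetComplement (bottom , top , meet-neg) x = bottom x , greatest
    where
    -- If x ∧ b is a least element then b = b ∧ ¬(x ∧ ¬x) = b ∧ ¬(b ∧ x) ≼ ¬x.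
    greatest : ∀ b → (∀ c → x ∧ b ≼ c) → b ≼ ¬ x
    greatest b x∧b-least = subst (_≼ ¬ x) b∧¬[b∧x]≡b (meet-neg b x)
      where
      b∧¬[b∧x]≡b : b ∧ ¬ (b ∧ x) ≡ b
      b∧¬[b∧x]≡b = begin
        b ∧ ¬ (b ∧ x)      ≡⟨ cong (λ t → b ∧ ¬ t) (∧-comm b x) ⟩
        b ∧ ¬ (x ∧ b)      ≡⟨ cong (λ t → b ∧ ¬ t) (≼-antisym (x∧b-least _) (bottom x _)) ⟩
        b ∧ 𝟏 x            ≡⟨ top x b ⟩
        b                  ∎

  module MeetComplemented (N : NegIsMeetComplement) where

    bottom : ∀ x c → x ∧ ¬ x ≼ c
    bottom x = proj₁ (N x)

    ¬-greatest : ∀ {x b} → (∀ c → x ∧ b ≼ c) → b ≼ ¬ x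
    ¬-greatest {x} = proj₂ (N x) _

    𝟏-top : ∀ x → IsTop (𝟏 x)
    𝟏-top x c = ¬-greatest λ d → ≼-trans (x∧y≼x _ c) (bottom x d)

    ¬-antitone : ∀ {x y} → x ≼ y → ¬ y ≼ ¬ x
    ¬-antitone {y = y} p = ¬-greatest λ c → ≼-trans (∧-mono p (≼-refl (¬ y))) (bottom y c)

    negAxioms : NegAxioms
    negAxioms = bottom , 𝟏-top , λ x y → ¬-greatest λ c →
      subst (_≼ c) (meet-rotate x y) (bottom (x ∧ y) c)
      where
      meet-rotate : ∀ x y → (x ∧ y) ∧ ¬ (x ∧ y) ≡ y ∧ (x ∧ ¬ (x ∧ y))
      meet-rotate x y = trans (cong (_∧ ¬ (x ∧ y)) (∧-comm x y)) (∧-assoc y x _)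

    BoxIsMax : Set a
    BoxIsMax = ∀ x → IsMax (λ b → IsTop (x ∨ ¬ b)) (□ x)

    BoxAxioms : Set a
    BoxAxioms = (∀ x → x ∨ ¬ (□ x) ≡ 𝟏 x)
              × (∀ x → □ (𝟏 x) ≡ 𝟏 x)
              × (∀ x y → □ (x ∨ ¬ y) ∧ y ≡ □ x ∧ y)

    boxIsMax⇒boxAxioms : BoxIsMax → BoxAxioms
    boxIsMax⇒boxAxioms Bx = box-top , box-𝟏 , box-absorb
      where
      box-greatest : ∀ {x b} → IsTop (x ∨ ¬ b) → b ≼ □ x
      box-greatest {x} = proj₂ (Bx x) _

      □-mono : ∀ {x y} → x ≼ y → □ x ≼ □ y
      □-mono {x} p = box-greatest λ c → ≼-trans (proj₁ (Bx x) c) (∨-mono p (≼-refl _))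

      box-top : ∀ x → x ∨ ¬ (□ x) ≡ 𝟏 x
      box-top x = top-unique (proj₁ (Bx x)) (𝟏-top x)

      box-𝟏 : ∀ x → □ (𝟏 x) ≡ 𝟏 x
      box-𝟏 x = ≼-antisym (𝟏-top x _) (box-greatest λ c → ≼-trans (𝟏-top x c) (x≼x∨y _ _))

      -- u = □(x ∨ ¬y) ∧ y lies below □ x, because ¬u is above both ¬y and
      -- ¬□(x ∨ ¬y), so that x ∨ ¬u is above the top x ∨ ¬y ∨ ¬□(x ∨ ¬y).
      box-absorb : ∀ x y → □ (x ∨ ¬ y) ∧ y ≡ □ x ∧ y
      box-absorb x y = ≼-antisym (∧-greatest (box-greatest u-co-top) (x∧y≼y _ y))
                                 (∧-mono (□-mono (x≼x∨y x (¬ y))) (≼-refl y))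
        where
        u = □ (x ∨ ¬ y) ∧ y
        u-co-top : IsTop (x ∨ ¬ u)
        u-co-top c = ≼-trans (proj₁ (Bx (x ∨ ¬ y)) c)
          (subst (_≼ x ∨ ¬ u) (sym (∨-assoc x (¬ y) _))
            (∨-mono (≼-refl x) (∨-least (¬-antitone (x∧y≼y _ y)) (¬-antitone (x∧y≼x _ y)))))

    boxAxioms⇒boxIsMax : BoxAxioms → BoxIsMax
    boxAxioms⇒boxIsMax (box-top , box-𝟏 , box-absorb) x =
      subst IsTop (sym (box-top x)) (𝟏-top x) , box-greatest
      where
      box-greatest : ∀ b → IsTop (x ∨ ¬ b) → b ≼ □ x
      box-greatest b x∨¬b-top = begin
        b ∧ □ x              ≡⟨ ∧-comm b (□ x) ⟩
        □ x ∧ b              ≡⟨ box-absorb x b ⟨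
        □ (x ∨ ¬ b) ∧ b      ≡⟨ cong (λ t → □ t ∧ b) (top-unique x∨¬b-top (𝟏-top x)) ⟩
        □ (𝟏 x) ∧ b          ≡⟨ cong (_∧ b) (box-𝟏 x) ⟩
        𝟏 x ∧ b              ≡⟨ ∧-comm (𝟏 x) b ⟩
        b ∧ 𝟏 x              ≡⟨ 𝟏-top x b ⟩
        b                    ∎

    boxIsMax⇔boxAxioms : BoxIsMax ⇔ BoxAxioms
    boxIsMax⇔boxAxioms = mk⇔ boxIsMax⇒boxAxioms boxAxioms⇒boxIsMax

    DiamondIsMin : Set a
    DiamondIsMin = ∀ x → IsMin (λ b → IsTop (¬ x ∨ b)) (◇ x)

    DiamondAxioms : Set a
    DiamondAxioms = (∀ x → ¬ x ∨ ◇ x ≡ 𝟏 x)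
                  × (∀ x y → ◇ x ≼ ◇ (x ∨ y))
                  × (∀ x → ◇ (□ x) ≼ x)

    -- The identities for ◇ only make sense relative to □ (through ◇□x ≼ x),
    -- so this equivalence assumes □ already has its universal property.
    diamondIsMin⇔diamondAxioms : BoxIsMax → DiamondIsMin ⇔ DiamondAxioms
    diamondIsMin⇔diamondAxioms Bx = mk⇔ sound complete
      where
      sound : DiamondIsMin → DiamondAxioms
      sound Dm = (λ x → top-unique (proj₁ (Dm x)) (𝟏-top x))
               , (λ x y → proj₂ (Dm x) _ λ c →
                    ≼-trans (proj₁ (Dm (x ∨ y)) c) (∨-mono (¬-antitone (x≼x∨y x y)) (≼-refl _)))
               , (λ x → proj₂ (Dm (□ x)) x (top-comm (proj₁ (Bx x))))

      complete : DiamondAxioms → DiamondIsMin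
      complete (diamond-top , diamond-join , diamond-box) x =
        subst IsTop (sym (diamond-top x)) (𝟏-top x) , diamond-least
        where
        ◇-mono : ∀ {u v} → u ≼ v → ◇ u ≼ ◇ v
        ◇-mono {u} p = subst (λ t → ◇ u ≼ ◇ t) (≼⇒∨≡ p) (diamond-join u _)

        -- If ¬x ∨ b = 1 then x ≼ □ b, hence ◇x ≼ ◇□b ≼ b.
        diamond-least : ∀ b → IsTop (¬ x ∨ b) → ◇ x ≼ b
        diamond-least b ¬x∨b-top =
          ≼-trans (◇-mono (proj₂ (Bx b) x (top-comm ¬x∨b-top))) (diamond-box b)

  negIsMeetComplement⇔negAxioms : NegIsMeetComplement ⇔ NegAxioms
  negIsMeetComplement⇔negAxioms =
    mk⇔ MeetComplemented.negAxioms negAxioms⇒negIsMeetComplement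

mainTheorem2 : ∀ {a : Level} (𝔸 : Alg a) → InK 𝔸 ⇔ Axioms 𝔸
mainTheorem2 𝔸 = mk⇔ soundness completeness
  where
  open Equivalence using (to; from)

  soundness : InK 𝔸 → Axioms 𝔸
  soundness (L , N , Bx , Dm) =
    let open Theory 𝔸 L
        open MeetComplemented N
        (a₂ , a₃ , a₄) = to negIsMeetComplement⇔negAxioms N
        (a₅ , a₆ , a₇) = to boxIsMax⇔boxAxioms Bx
        (a₈ , a₉ , a₁₀) = to (diamondIsMin⇔diamondAxioms Bx) Dm
    in L , a₂ , a₃ , a₄ , a₅ , a₆ , a₇ , a₈ , a₉ , a₁₀

  completeness : Axioms 𝔸 → InK 𝔸
  completeness (L , a₂ , a₃ , a₄ , a₅ , a₆ , a₇ , a₈ , a₉ , a₁₀) =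
    let open Theory 𝔸 L
        N = from negIsMeetComplement⇔negAxioms (a₂ , a₃ , a₄)
        open MeetComplemented N
        Bx = from boxIsMax⇔boxAxioms (a₅ , a₆ , a₇)
    in L , N , Bx , from (diamondIsMin⇔diamondAxioms Bx) (a₈ , a₉ , a₁₀)
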